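{- For every BPL-model $\mathfrak{M}$ and every $\mathcal{L}_{\mathrm{BPL}}$-formula $A$: $A$ is true at every state of $\mathfrak{M}$ if and only if $A$ is true at every state of the ternary model $\mathfrak{J}^{\mathfrak{M}}$.
   Context: $\mathcal{L}_{\mathrm{BPL}}$-formulas are built from propositional letters and $\bot,\top$ by $\wedge,\vee,\rightarrow$. A BPL-model is $\mathfrak{M}=(W,R,V)$ with $W$ nonempty, $R\subseteq W^2$ transitive, and $V$ assigning to each propositional letter a subset of $W$ such that $w\in V(p)$ and $wRu$ imply $u\in V(p)$. Satisfaction: $p$ via $V$; $\top$ always true, $\bot$ never; $\wedge,\vee$ pointwise; $\mathfrak{M},w\models A\rightarrow B$ iff for all $v$ with $wRv$, $\mathfrak{M},v\models A$ implies $\mathfrak{M},v\models B$. A ternary model is $\mathfrak{J}=(W',R',V')$ with $W'$ nonempty, $R'\subseteq W'^3$, $V'$ a valuation; satisfaction: $p$ via $V'$; $\top$ always, $\bot$ never; $\wedge,\vee$ pointwise; $\mathfrak{J},a\models A\rightarrow B$ iff for all $x,y$ with $R'(x,y,a)$, $\mathfrak{J},y\models A$ implies $\mathfrak{J},x\models B$. Given a BPL-model $\mathfrak{M}=(W,R,V)$, $\mathfrak{J}^{\mathfrak{M}}=(W',R',V')$ is defined by: $W'=\{a_1,a_2: a\in W\}$ (two distinct copies of each state); $R'=\{(b_1,b_2,a_1),(b_2,b_1,a_1),(b_1,b_2,a_2),(b_2,b_1,a_2): a,b\in W,\ aRb\}$; $V'(p)=\{a_i: i\in\{1,2\},\ a\in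 V(p)\}$. -}

module Defs where

open import Data.Nat using (ℕ)
open import Data.Product using (_×_; _,_; Σ; proj₁)
open import Data.Sum using (_⊎_)
open import Data.Empty using (⊥)
open import Data.Unit using (⊤)
open import Data.Bool using (Bool; true; false)
open import Relation.Binary.PropositionalEquality using (_≡_)

data Formula : Set where
  var  : ℕ → Formula
  ⊥ᶠ   : Formula
  ⊤ᶠ   : Formula
  _∧ᶠ_ : Formula → Formula → Formula
  _∨ᶠ_ : Formula → Formula → Formula
  _⇒ᶠ_ : Formula → Formula → Formula

record BPLModel : Set₁ where
  field
    W          : Set
    inhabited  : W
    R          : W → W → Set
    R-trans    : ∀ {x y z} → R x y → R y z → R x z
    V          : ℕ → W → Set
    V-persist  : ∀ {p w u} → V p w → R w u → V p u

record TernaryModel : Set₁ where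
  field
    W'         : Set
    inhabited' : W'
    R'         : W' → W' → W' → Set
    V'         : ℕ → W' → Set

module _ (M : BPLModel) where
  open BPLModel M
  _⊨ᴮ_ : W → Formula → Set
  w ⊨ᴮ var p   = V p w
  w ⊨ᴮ ⊥ᶠ      = ⊥
  w ⊨ᴮ ⊤ᶠ      = ⊤
  w ⊨ᴮ (A ∧ᶠ B) = (w ⊨ᴮ A) × (w ⊨ᴮ B)
  w ⊨ᴮ (A ∨ᶠ B) = (w ⊨ᴮ A) ⊎ (w ⊨ᴮ B)
  w ⊨ᴮ (A ⇒ᶠ B) = ∀ v → R w v → v ⊨ᴮ A → v ⊨ᴮ B

module _ (J : TernaryModel) where
  open TernaryModel J
  _⊨ᵀ_ : W' → Formula → Set
  a ⊨ᵀ var p   = V' p a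
  a ⊨ᵀ ⊥ᶠ      = ⊥
  a ⊨ᵀ ⊤ᶠ      = ⊤
  a ⊨ᵀ (A ∧ᶠ B) = (a ⊨ᵀ A) × (a ⊨ᵀ B)
  a ⊨ᵀ (A ∨ᶠ B) = (a ⊨ᵀ A) ⊎ (a ⊨ᵀ B)
  a ⊨ᵀ (A ⇒ᶠ B) = ∀ x y → R' x y a → y ⊨ᵀ A → x ⊨ᵀ B

BPLValid : (M : BPLModel) → Formula → Set
BPLValid M A = ∀ w → _⊨ᴮ_ M w A

TernaryValid : (J : TernaryModel) → Formula → Set
TernaryValid J A = ∀ a → _⊨ᵀ_ J a A

-- J^M: states are pairs (a , i) with i : Bool encoding the copies a₁ (true), a₂ (false)
-- R'((b,i),(b',j),(a,k)) iff b ≡ b', i ≢ j, and aRb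
-- (these are exactly the triples (b₁,b₂,a_k),(b₂,b₁,a_k) with aRb)
module _ (M : BPLModel) where
  open BPLModel M
  data JR : W × Bool → W × Bool → W × Bool → Set where
    r12 : ∀ {a b k} → R a b → JR (b , true)  (b , false) (a , k)
    r21 : ∀ {a b k} → R a b → JR (b , false) (b , true)  (a , k)

  JM : TernaryModel
  JM = record
    { W'         = W × Bool
    ; inhabited' = inhabited , true
    ; R'         = JR
    ; V'         = λ p a → V p (proj₁ a)
    }

-- The only interesting case is implication: the triples R'(x, y, aₖ) are exactly
-- (b₁, b₂, aₖ) and (b₂, b₁, aₖ) with aRb, so x and y are copies of one successor b
-- of a, and the induction hypothesis for A and B at b turns the ternary clause
-- into the relational one.
module Submission where

open import Defs
open import Data.Product using (_×_; _,_; proj₁; proj₂)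
open import Data.Sum using (inj₁; inj₂)
open import Data.Bool using (Bool; true; false)
open import Function.Bundles using (_⇔_; mk⇔; Equivalence)

module _ (M : BPLModel) where
  open BPLModel M

  ⊨ᴮ⇒⊨ᵀ : ∀ A w k → _⊨ᴮ_ M w A → _⊨ᵀ_ (JM M) (w , k) A
  ⊨ᵀ⇒⊨ᴮ : ∀ A w k → _⊨ᵀ_ (JM M) (w , k) A → _⊨ᴮ_ M w A

  ⊨ᴮ⇒⊨ᵀ (var p)   w k w⊨p          = w⊨p
  ⊨ᴮ⇒⊨ᵀ ⊤ᶠ        w k _            = _
  ⊨ᴮ⇒⊨ᵀ (A ∧ᶠ B)  w k (w⊨A , w⊨B)  = ⊨ᴮ⇒⊨ᵀ A w k w⊨A , ⊨ᴮ⇒⊨ᵀ B w k w⊨B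
  ⊨ᴮ⇒⊨ᵀ (A ∨ᶠ B)  w k (inj₁ w⊨A)   = inj₁ (⊨ᴮ⇒⊨ᵀ A w k w⊨A)
  ⊨ᴮ⇒⊨ᵀ (A ∨ᶠ B)  w k (inj₂ w⊨B)   = inj₂ (⊨ᴮ⇒⊨ᵀ B w k w⊨B)
  ⊨ᴮ⇒⊨ᵀ (A ⇒ᶠ B)  w k w⊨A⇒B _ _ (r12 {b = b} wRb) b₂⊨A =
    ⊨ᴮ⇒⊨ᵀ B b true  (w⊨A⇒B b wRb (⊨ᵀ⇒⊨ᴮ A b false b₂⊨A))
  ⊨ᴮ⇒⊨ᵀ (A ⇒ᶠ B)  w k w⊨A⇒B _ _ (r21 {b = b} wRb) b₁⊨A =
    ⊨ᴮ⇒⊨ᵀ B b false (w⊨A⇒B b wRb (⊨ᵀ⇒⊨ᴮ A b true b₁⊨A))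

  ⊨ᵀ⇒⊨ᴮ (var p)   w k w⊨p          = w⊨p
  ⊨ᵀ⇒⊨ᴮ ⊤ᶠ        w k _            = _
  ⊨ᵀ⇒⊨ᴮ (A ∧ᶠ B)  w k (w⊨A , w⊨B)  = ⊨ᵀ⇒⊨ᴮ A w k w⊨A , ⊨ᵀ⇒⊨ᴮ B w k w⊨B
  ⊨ᵀ⇒⊨ᴮ (A ∨ᶠ B)  w k (inj₁ w⊨A)   = inj₁ (⊨ᵀ⇒⊨ᴮ A w k w⊨A)
  ⊨ᵀ⇒⊨ᴮ (A ∨ᶠ B)  w k (inj₂ w⊨B)   = inj₂ (⊨ᵀ⇒⊨ᴮ B w k w⊨B)
  ⊨ᵀ⇒⊨ᴮ (A ⇒ᶠ B)  w k wₖ⊨A⇒B v wRv v⊨A =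
    ⊨ᵀ⇒⊨ᴮ B v true (wₖ⊨A⇒B (v , true) (v , false) (r12 wRv) (⊨ᴮ⇒⊨ᵀ A v false v⊨A))

  ⊨ᴮ⇔⊨ᵀ : ∀ A w k → _⊨ᴮ_ M w A ⇔ _⊨ᵀ_ (JM M) (w , k) A
  ⊨ᴮ⇔⊨ᵀ A w k = mk⇔ (⊨ᴮ⇒⊨ᵀ A w k) (⊨ᵀ⇒⊨ᴮ A w k)

corollary1 : (M : BPLModel) (A : Formula) →
    (BPLValid M A → TernaryValid (JM M) A) × (TernaryValid (JM M) A → BPLValid M A)
corollary1 M A =
    (λ valid (w , k) → Equivalence.to   (⊨ᴮ⇔⊨ᵀ M A w k) (valid w))
  , (λ valid w       → Equivalence.from (⊨ᴮ⇔⊨ᵀ M A w true) (valid (w , true)))
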